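{- Let $\vec U=(\vec U,\le,{}^*,\vee,\wedge,|\cdot|)$ be a submodular distributive universe of separations. Then for every pairwise distinguishable set $\mathcal P$ of strongly robust profiles in $\vec U$ there is a nested set $T\subseteq U$ of separations such that: (i) every two profiles in $\mathcal P$ are distinguished by some separation in $T$; (ii) for any profile $P\in\mathcal P$, any maximal $\vec s\in P\cap\vec T$ and any $\vec s'\in P$ with $\vec s\le\vec s'$ we have $|\vec s|\le|\vec s'|$.
   Context: A separation system is a finite poset with an order-reversing involution ${}^*$; write $\overleftarrow s:=\vec s^{\,*}$, $s:=\{\vec s,\overleftarrow s\}$; for a set $T$ of unoriented separations, $\vec T$ is the set of their orientations. $r,s$ are nested if some orientations satisfy $\vec r\le\vec s$; a set is nested if pairwise nested. A universe is a separation system whose poset is a lattice ($\vee,\wedge$); distributive if $\vec a\vee(\vec b\wedge\vec c)=(\vec a\vee\vec b)\wedge(\vec a\vee\vec c)$ always; submodular if it carries $|\cdot|:\vec U\to\mathbb N_0$ with $|\vec a|=|\overleftarrow a|=:|a|$ and $|\vec a|+|\vec b|\ge|\vec a\vee\vec b|+|\vec a\wedge\vec b|$. $\vec S_k:=\{\vec a\in\vec U:|\vec a|<k\}$. A profile in $\vec U$ (a $k$-profile for some $k$) is a consistent orientation $P$ of $S_k$ (exactly one orientation of each element, no $\vec a,\vec b$ with $a\ne b$, $\overleftarrow a\le\vec b$) with $\overleftarrow a\wedge\overleftarrow b\notin P$ for all $\vec a,\vec b\in P$; it is strongly robust if for any $\vec a\in P$, $\vec b\in\vec U$ such that $\vec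 a\vee\vec b$ and $\vec a\vee\overleftarrow b$ both have order at most $|\vec a|$, one of them lies in $P$. A separation $s$ distinguishes profiles $P_1,P_2$ if it has an orientation with $\vec s\in P_1$, $\overleftarrow s\in P_2$; a set of profiles is distinguishable if every two of its members are distinguished by some separation. -}

module Defs where

open import Data.Nat using (ℕ; _+_; _≤_; _<_)
open import Data.Fin using (Fin)
open import Data.List using (List)
open import Data.List.Membership.Propositional using (_∈_)
open import Data.Product using (Σ; ∃; _×_; _,_)
open import Data.Sum using (_⊎_)
open import Data.Empty using (⊥)
open import Relation.Nullary using (¬_)
open import Relation.Binary.PropositionalEquality using (_≡_; _≢_)
open import Relation.Binary.Definitions using (DecidableEquality)
open import Relation.Binary.Lattice.Structures using (IsLattice)

record Universe : Set₁ where
  field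
    Carrier   : Set
    _≤ˢ_      : Carrier → Carrier → Set
    _*        : Carrier → Carrier
    _∨_       : Carrier → Carrier → Carrier
    _∧_       : Carrier → Carrier → Carrier
    ∣_∣       : Carrier → ℕ
    -- finiteness of the underlying poset (classically automatic decidability of equality)
    elements  : List Carrier
    complete  : ∀ x → x ∈ elements
    _≟_       : DecidableEquality Carrier
    isLattice : IsLattice _≡_ _≤ˢ_ _∨_ _∧_
    *-invol   : ∀ a → (a *) * ≡ a
    *-rev     : ∀ a b → a ≤ˢ b → (b *) ≤ˢ (a *)
    distrib   : ∀ a b c → a ∨ (b ∧ c) ≡ (a ∨ b) ∧ (a ∨ c)
    ∣∣-sym    : ∀ a → ∣ a * ∣ ≡ ∣ a ∣
    submod    : ∀ a b → ∣ a ∨ b ∣ + ∣ a ∧ b ∣ ≤ ∣ a ∣ + ∣ b ∣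

module _ (U : Universe) where
  open Universe U

  OSet : Set₁
  OSet = Carrier → Set

  SameSep : Carrier → Carrier → Set
  SameSep a b = (b ≡ a) ⊎ (b ≡ a *)

  record IsKProfile (k : ℕ) (P : OSet) : Set where
    field
      inSk       : ∀ a → P a → ∣ a ∣ < k
      orients    : ∀ a → ∣ a ∣ < k → P a ⊎ P (a *)
      unique     : ∀ a → P a → P (a *) → a ≡ a *
      consistent : ∀ a b → P a → P b → ¬ SameSep a b → ¬ ((a *) ≤ˢ b)
      profile    : ∀ a b → P a → P b → ¬ P ((a *) ∧ (b *))

  IsProfile : OSet → Set
  IsProfile P = ∃ λ k → IsKProfile k P

  StronglyRobust : OSet → Set
  StronglyRobust P = ∀ a b → P a → ∣ a ∨ b ∣ ≤ ∣ a ∣ → ∣ a ∨ (b *) ∣ ≤ ∣ a ∣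
                     → P (a ∨ b) ⊎ P (a ∨ (b *))

  Distinguishes : Carrier → OSet → OSet → Set
  Distinguishes s P₁ P₂ = Σ Carrier λ x → SameSep s x × P₁ x × P₂ (x *)

  Distinguishable : (m : ℕ) → (Fin m → OSet) → Set
  Distinguishable m 𝒫 = ∀ i j → i ≢ j → ∃ λ s → Distinguishes s (𝒫 i) (𝒫 j)

  -- T⃗ is the set of orientations of a set T of unoriented separations
  ClosedUnder* : OSet → Set
  ClosedUnder* T = ∀ a → T a → T (a *)

  Nested : Carrier → Carrier → Set
  Nested r s = (r ≤ˢ s) ⊎ (r ≤ˢ (s *)) ⊎ ((r *) ≤ˢ s) ⊎ ((r *) ≤ˢ (s *))

  NestedSet : OSet → Set
  NestedSet T = ∀ r s → T r → T s → Nested r s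

  MaximalIn : OSet → OSet → Carrier → Set
  MaximalIn P T s = P s × T s × (∀ t → P t → T t → s ≤ˢ t → t ≡ s)

-- Call x an efficient (i, j)-separation if x ∈ 𝒫 i, x * ∈ 𝒫 j and x has least order among
-- such separations. If r is efficient for some pair, s is efficient for (i, j), |r| ≤ |s| and
-- r crosses s, then one of the corners r ∨ s, r ∧ s, r * ∨ s, r * ∧ s is again efficient for
-- (i, j), is nested with r, and is nested with every separation nested with both r and s:
-- submodularity provides a corner of order at most |s|, and strong robustness rules out the
-- single configuration in which no corner qualifies. Adding
-- efficient separations by increasing order, each uncrossed against those already chosen, gives
-- a nested set T of efficient separations distinguishing all pairs. For (ii), a shorter s′ ≥ s
-- in 𝒫 i, with s maximal in 𝒫 i ∩ T and efficient for (a, b), would have s′ * ∈ 𝒫 a; the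
-- efficient (i, a)-separation in T is then shorter than s and cannot be nested with s.

module Submission where

open import Defs
open import Data.Nat using (ℕ; zero; suc; _+_; _≤_; _<_; _≤?_; _<?_; s≤s⁻¹) renaming (_≟_ to _≟ℕ_)
open import Data.Nat.Properties
  using (≤-refl; ≤-trans; ≤-antisym; <⇒≤; <-trans; ≤-<-trans; <-≤-trans; <-irrefl; m≤n⇒m<n∨m≡n; m≤n⇒m≤1+n;
         ≰⇒>; <⇒≱; +-comm; +-monoˡ-<; +-cancelˡ-<)
open import Data.Fin using (Fin)
open import Data.List using (List; []; _∷_; filter; map; allFin; cartesianProduct)
open import Data.List.Membership.Propositional using (_∈_; lose)
open import Data.List.Membership.Propositional.Properties
  using (∈-filter⁺; ∈-map⁺; ∈-allFin; ∈-cartesianProduct⁺)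
open import Data.List.Relation.Unary.All using (lookup)
open import Data.List.Relation.Unary.All.Properties using (all-filter)
open import Data.List.Relation.Unary.Any using (here; there; any?; satisfied)
open import Data.List.Relation.Binary.Subset.Propositional using (_⊆_)
open import Data.List.Extrema.Nat using (argmin; argmin-all; f[argmin]≤f[xs]; max; xs≤max)
open import Data.Product using (Σ; _×_; _,_; proj₁; proj₂)
open import Data.Sum using (_⊎_; inj₁; inj₂; [_,_]′)
open import Data.Empty using (⊥; ⊥-elim)
open import Relation.Nullary using (¬_; Dec; yes; no)
open import Relation.Nullary.Decidable using (_×-dec_)
open import Relation.Unary using (Decidable)
open import Function using (_∘_; id)
open import Relation.Binary.PropositionalEquality
  using (_≡_; _≢_; refl; cong; sym; trans; subst; subst₂)
import Relation.Binary.Lattice.Structures as LatticeStructures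

∃-minimal : ∀ {A : Set} {Q : A → Set} (f : A → ℕ) (xs : List A) → (∀ x → x ∈ xs) →
            Decidable Q → ∀ {x} → Q x → Σ A λ y → Q y × (∀ z → Q z → f y ≤ f z)
∃-minimal f xs complete Q? {x} qx =
  y , argmin-all f qx (all-filter Q? xs) ,
  λ z qz → lookup (f[argmin]≤f[xs] x (filter Q? xs)) (∈-filter⁺ Q? (complete z) qz)
  where y = argmin f x (filter Q? xs)

a+b≤c+d⇒d<a⇒b<c : ∀ {a b c d} → a + b ≤ c + d → d < a → b < c
a+b≤c+d⇒d<a⇒b<c {a} {b} {c} {d} sum≤ d<a =
  +-cancelˡ-< d b c (<-≤-trans (+-monoˡ-< b d<a) (subst (a + b ≤_) (+-comm c d) sum≤))

pattern ⟨≤⟩ p = inj₁ p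
pattern ⟨≤*⟩ p = inj₂ (inj₁ p)
pattern ⟨*≤⟩ p = inj₂ (inj₂ (inj₁ p))
pattern ⟨*≤*⟩ p = inj₂ (inj₂ (inj₂ p))

module Separations (U : Universe) where
  open Universe U public
  open LatticeStructures.IsLattice isLattice public
    using (x≤x∨y; y≤x∨y; ∨-least; x∧y≤x; x∧y≤y; ∧-greatest; antisym)
    renaming (refl to ≤ˢ-refl; trans to ≤ˢ-trans)

  *-antitone : ∀ {a b} → a ≤ˢ b → (b *) ≤ˢ (a *)
  *-antitone {a} {b} = *-rev a b

  a≤b*⇒b≤a* : ∀ {a b} → a ≤ˢ (b *) → b ≤ˢ (a *)
  a≤b*⇒b≤a* {a} {b} p = subst (_≤ˢ (a *)) (*-invol b) (*-antitone p)

  a*≤b⇒b*≤a : ∀ {a b} → (a *) ≤ˢ b → (b *) ≤ˢ a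
  a*≤b⇒b*≤a {a} {b} p = subst ((b *) ≤ˢ_) (*-invol a) (*-antitone p)

  a*≤b*⇒b≤a : ∀ {a b} → (a *) ≤ˢ (b *) → b ≤ˢ a
  a*≤b*⇒b≤a {a} {b} p = subst (b ≤ˢ_) (*-invol a) (a≤b*⇒b≤a* p)

  *-∨ : ∀ x y → ((x ∨ y) *) ≡ ((x *) ∧ (y *))
  *-∨ x y = antisym
    (∧-greatest (*-antitone (x≤x∨y x y)) (*-antitone (y≤x∨y x y)))
    (a≤b*⇒b≤a* (∨-least (a≤b*⇒b≤a* (x∧y≤x (x *) (y *))) (a≤b*⇒b≤a* (x∧y≤y (x *) (y *)))))

  *-∧ : ∀ x y → ((x ∧ y) *) ≡ ((x *) ∨ (y *))
  *-∧ x y = antisym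
    (a*≤b⇒b*≤a (∧-greatest (a*≤b⇒b*≤a (x≤x∨y (x *) (y *))) (a*≤b⇒b*≤a (y≤x∨y (x *) (y *)))))
    (∨-least (*-antitone (x∧y≤x x y)) (*-antitone (x∧y≤y x y)))

  ∧-idem : ∀ x → (x ∧ x) ≡ x
  ∧-idem x = antisym (x∧y≤x x x) (∧-greatest ≤ˢ-refl ≤ˢ-refl)

  ∣*∨*∣ : ∀ x y → ∣ (x *) ∨ (y *) ∣ ≡ ∣ x ∧ y ∣
  ∣*∨*∣ x y = trans (cong ∣_∣ (sym (*-∧ x y))) (∣∣-sym (x ∧ y))

  ∣∧∣<∣∣-if-∣∣<∣∨∣ : ∀ {a b} → ∣ b ∣ < ∣ a ∨ b ∣ → ∣ a ∧ b ∣ < ∣ a ∣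
  ∣∧∣<∣∣-if-∣∣<∣∨∣ {a} {b} = a+b≤c+d⇒d<a⇒b<c (submod a b)

  ∣∨∣<∣∣-if-∣∣<∣∧∣ : ∀ {a b} → ∣ b ∣ < ∣ a ∧ b ∣ → ∣ a ∨ b ∣ < ∣ a ∣
  ∣∨∣<∣∣-if-∣∣<∣∧∣ {a} {b} = a+b≤c+d⇒d<a⇒b<c (subst (_≤ ∣ a ∣ + ∣ b ∣) (+-comm ∣ a ∨ b ∣ ∣ a ∧ b ∣) (submod a b))

  _≤ˢ?_ : ∀ a b → Dec (a ≤ˢ b)
  a ≤ˢ? b with (a ∨ b) ≟ b
  ... | yes a∨b≡b = yes (subst (a ≤ˢ_) a∨b≡b (x≤x∨y a b))
  ... | no a∨b≢b = no λ a≤b → a∨b≢b (antisym (∨-least a≤b ≤ˢ-refl) (y≤x∨y a b))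

  **⁺ : ∀ (P : OSet U) {x} → P x → P ((x *) *)
  **⁺ P {x} = subst P (sym (*-invol x))

  SameSep-∣∣ : ∀ {a b} → SameSep U a b → ∣ a ∣ ≡ ∣ b ∣
  SameSep-∣∣ (inj₁ b≡a) = cong ∣_∣ (sym b≡a)
  SameSep-∣∣ {a} (inj₂ b≡a*) = trans (sym (∣∣-sym a)) (cong ∣_∣ (sym b≡a*))

  Crossing : Carrier → Carrier → Set
  Crossing r s = ¬ Nested U r s

  Nested-refl : ∀ {a} → Nested U a a
  Nested-refl = ⟨≤⟩ ≤ˢ-refl

  Nested-sym : ∀ {a b} → Nested U a b → Nested U b a
  Nested-sym (⟨≤⟩ p) = ⟨*≤*⟩ (*-antitone p)
  Nested-sym (⟨≤*⟩ p) = ⟨≤*⟩ (a≤b*⇒b≤a* p)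
  Nested-sym (⟨*≤⟩ p) = ⟨*≤⟩ (a*≤b⇒b*≤a p)
  Nested-sym (⟨*≤*⟩ p) = ⟨≤⟩ (a*≤b*⇒b≤a p)

  Nested-*ˡ : ∀ {a b} → Nested U a b → Nested U (a *) b
  Nested-*ˡ {a} {b} (⟨≤⟩ p) = ⟨*≤⟩ (subst (_≤ˢ b) (sym (*-invol a)) p)
  Nested-*ˡ {a} {b} (⟨≤*⟩ p) = ⟨*≤*⟩ (subst (_≤ˢ (b *)) (sym (*-invol a)) p)
  Nested-*ˡ (⟨*≤⟩ p) = ⟨≤⟩ p
  Nested-*ˡ (⟨*≤*⟩ p) = ⟨≤*⟩ p

  Nested-*ˡ⁻ : ∀ {a b} → Nested U (a *) b → Nested U a b
  Nested-*ˡ⁻ {a} {b} n = subst (λ x → Nested U x b) (*-invol a) (Nested-*ˡ n)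

  Nested-*ʳ : ∀ {a b} → Nested U a b → Nested U a (b *)
  Nested-*ʳ n = Nested-sym (Nested-*ˡ (Nested-sym n))

  Nested? : ∀ a b → Dec (Nested U a b)
  Nested? a b with a ≤ˢ? b | a ≤ˢ? (b *) | (a *) ≤ˢ? b | (a *) ≤ˢ? (b *)
  ... | yes p | _     | _     | _     = yes (⟨≤⟩ p)
  ... | no _  | yes p | _     | _     = yes (⟨≤*⟩ p)
  ... | no _  | no _  | yes p | _     = yes (⟨*≤⟩ p)
  ... | no _  | no _  | no _  | yes p = yes (⟨*≤*⟩ p)
  ... | no ¬1 | no ¬2 | no ¬3 | no ¬4 = no λ where
    (⟨≤⟩ p) → ¬1 p
    (⟨≤*⟩ p) → ¬2 p
    (⟨*≤⟩ p) → ¬3 p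
    (⟨*≤*⟩ p) → ¬4 p

  Nested-∧ : ∀ {x y t} → Crossing x y → Nested U t x → Nested U t y → Nested U t (x ∧ y)
  Nested-∧ {x} {y} x⋈y = corner
    where
      x*≤[x∧y]* : (x *) ≤ˢ ((x ∧ y) *)
      x*≤[x∧y]* = *-antitone (x∧y≤x x y)
      y*≤[x∧y]* : (y *) ≤ˢ ((x ∧ y) *)
      y*≤[x∧y]* = *-antitone (x∧y≤y x y)
      corner : ∀ {t} → Nested U t x → Nested U t y → Nested U t (x ∧ y)
      corner (⟨≤*⟩ p) _ = ⟨≤*⟩ (≤ˢ-trans p x*≤[x∧y]*)
      corner (⟨*≤*⟩ p) _ = ⟨*≤*⟩ (≤ˢ-trans p x*≤[x∧y]*)
      corner _ (⟨≤*⟩ p) = ⟨≤*⟩ (≤ˢ-trans p y*≤[x∧y]*)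
      corner _ (⟨*≤*⟩ p) = ⟨*≤*⟩ (≤ˢ-trans p y*≤[x∧y]*)
      corner (⟨≤⟩ p) (⟨≤⟩ q) = ⟨≤⟩ (∧-greatest p q)
      corner (⟨*≤⟩ p) (⟨*≤⟩ q) = ⟨*≤⟩ (∧-greatest p q)
      corner (⟨≤⟩ p) (⟨*≤⟩ q) = ⊥-elim (x⋈y (⟨*≤⟩ (≤ˢ-trans (*-antitone p) q)))
      corner (⟨*≤⟩ p) (⟨≤⟩ q) = ⊥-elim (x⋈y (⟨*≤⟩ (≤ˢ-trans (a*≤b⇒b*≤a p) q)))

  Nested-∨ : ∀ {x y t} → Crossing x y → Nested U t x → Nested U t y → Nested U t (x ∨ y)
  Nested-∨ {x} {y} x⋈y = corner
    where
      corner : ∀ {t} → Nested U t x → Nested U t y → Nested U t (x ∨ y)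
      corner (⟨≤⟩ p) _ = ⟨≤⟩ (≤ˢ-trans p (x≤x∨y x y))
      corner (⟨*≤⟩ p) _ = ⟨*≤⟩ (≤ˢ-trans p (x≤x∨y x y))
      corner _ (⟨≤⟩ p) = ⟨≤⟩ (≤ˢ-trans p (y≤x∨y x y))
      corner _ (⟨*≤⟩ p) = ⟨*≤⟩ (≤ˢ-trans p (y≤x∨y x y))
      corner (⟨≤*⟩ p) (⟨≤*⟩ q) = ⟨≤*⟩ (a≤b*⇒b≤a* (∨-least (a≤b*⇒b≤a* p) (a≤b*⇒b≤a* q)))
      corner (⟨*≤*⟩ p) (⟨*≤*⟩ q) = ⟨*≤*⟩ (*-antitone (∨-least (a*≤b*⇒b≤a p) (a*≤b*⇒b≤a q)))
      corner (⟨*≤*⟩ p) (⟨≤*⟩ q) = ⊥-elim (x⋈y (⟨≤*⟩ (≤ˢ-trans (a*≤b*⇒b≤a p) q)))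
      corner (⟨≤*⟩ p) (⟨*≤*⟩ q) = ⊥-elim (x⋈y (⟨≤*⟩ (a≤b*⇒b≤a* (≤ˢ-trans (a*≤b*⇒b≤a q) p))))

  Crossing-*ˡ : ∀ {w s} → Crossing w s → Crossing (w *) s
  Crossing-*ˡ w⋈s = w⋈s ∘ Nested-*ˡ⁻

  Crossing⇒s*≢[w∨s]** : ∀ {w s} → Crossing w s → (s *) ≢ (((w ∨ s) *) *)
  Crossing⇒s*≢[w∨s]** {w} {s} w⋈s s*≡ =
    w⋈s (⟨≤*⟩ (subst (w ≤ˢ_) (sym (trans s*≡ (*-invol (w ∨ s)))) (x≤x∨y w s)))

  Crossing⇒s≢[w∧s]* : ∀ {w s} → Crossing w s → s ≢ ((w ∧ s) *)
  Crossing⇒s≢[w∧s]* {w} {s} w⋈s s≡ =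
    w⋈s (⟨*≤⟩ (a*≤b⇒b*≤a (subst (_≤ˢ w) (sym (trans (cong _* s≡) (*-invol (w ∧ s)))) (x∧y≤x w s))))

  maxOrder : ℕ
  maxOrder = max 0 (map ∣_∣ elements)

  ∣∣≤maxOrder : ∀ x → ∣ x ∣ ≤ maxOrder
  ∣∣≤maxOrder x = lookup (xs≤max 0 (map ∣_∣ elements)) (∈-map⁺ ∣_∣ (complete x))

  NestedList : List Carrier → Set
  NestedList L = ∀ {x y} → x ∈ L → y ∈ L → Nested U x y

  Orientations : List Carrier → OSet U
  Orientations L x = Σ Carrier λ t → t ∈ L × SameSep U t x

  Orientations-closed : ∀ L → ClosedUnder* U (Orientations L)
  Orientations-closed L a (t , t∈L , inj₁ a≡t) = t , t∈L , inj₂ (cong _* a≡t)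
  Orientations-closed L a (t , t∈L , inj₂ a≡t*) = t , t∈L , inj₁ (trans (cong _* a≡t*) (*-invol t))

  SameSep-Nested : ∀ {t x y} → SameSep U t x → Nested U t y → Nested U x y
  SameSep-Nested (inj₁ refl) t∥y = t∥y
  SameSep-Nested (inj₂ refl) t∥y = Nested-*ˡ t∥y

  Orientations-nested : ∀ {L} → NestedList L → NestedSet U (Orientations L)
  Orientations-nested nestedL x y (t , t∈L , t~x) (u , u∈L , u~y) =
    SameSep-Nested t~x (Nested-sym (SameSep-Nested u~y (nestedL u∈L t∈L)))

module KProfile (U : Universe) {k : ℕ} {P : OSet U} (isKProfile : IsKProfile U k P) where
  open Separations U
  open IsKProfile isKProfile

  ¬both : ∀ {x} → P x → ¬ P (x *)
  ¬both {x} px px* = profile x x px px (subst P (sym (∧-idem (x *))) px*)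

  ∨-closed : ∀ {x y} → P x → P y → ∣ x ∨ y ∣ < k → P (x ∨ y)
  ∨-closed {x} {y} px py ∣x∨y∣<k with orients (x ∨ y) ∣x∨y∣<k
  ... | inj₁ p = p
  ... | inj₂ p* = ⊥-elim (profile x y px py (subst P (*-∨ x y) p*))

  ↓-closed : ∀ {x y} → P x → y ≤ˢ x → ∣ y ∣ < k → x ≢ (y *) → P y
  ↓-closed {x} {y} px y≤x ∣y∣<k x≢y* with orients y ∣y∣<k
  ... | inj₁ py = py
  ... | inj₂ py* with x ≟ y
  ...   | yes x≡y = subst P x≡y px
  ...   | no x≢y = ⊥-elim (consistent (y *) x py* px different (subst (_≤ˢ x) (sym (*-invol y)) y≤x))
    where
      different : ¬ SameSep U (y *) x
      different (inj₁ x≡y*) = x≢y* x≡y*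
      different (inj₂ x≡y**) = x≢y (trans x≡y** (*-invol y))

  ↓-closed-< : ∀ {x y} → P x → y ≤ˢ x → ∣ y ∣ < ∣ x ∣ → P y
  ↓-closed-< {x} {y} px y≤x ∣y∣<∣x∣ = ↓-closed px y≤x (<-trans ∣y∣<∣x∣ (inSk x px))
    λ x≡y* → <-irrefl (trans (sym (∣∣-sym y)) (cong ∣_∣ (sym x≡y*))) ∣y∣<∣x∣

  P? : Decidable P
  P? x with ∣ x ∣ <? k
  ... | no ∣x∣≮k = no λ px → ∣x∣≮k (inSk x px)
  ... | yes ∣x∣<k with orients x ∣x∣<k
  ...   | inj₁ px = yes px
  ...   | inj₂ px* = no λ px → ¬both px px*

module Efficiency (U : Universe) {m : ℕ} (𝒫 : Fin m → OSet U)
                  (isProfile : ∀ i → IsProfile U (𝒫 i)) where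
  open Separations U
  module 𝒫 i = KProfile U (proj₂ (isProfile i))

  k : Fin m → ℕ
  k i = proj₁ (isProfile i)

  ∣∣<k : ∀ i {x} → 𝒫 i x → ∣ x ∣ < k i
  ∣∣<k i {x} = IsKProfile.inSk (proj₂ (isProfile i)) x

  ∣*∣<k : ∀ i {x} → 𝒫 i (x *) → ∣ x ∣ < k i
  ∣*∣<k i {x} px* = subst (_< k i) (∣∣-sym x) (∣∣<k i px*)

  orient : ∀ i {x} → ∣ x ∣ < k i → 𝒫 i x ⊎ 𝒫 i (x *)
  orient i {x} = IsKProfile.orients (proj₂ (isProfile i)) x

  Separates : Fin m → Fin m → Carrier → Set
  Separates i j x = 𝒫 i x × 𝒫 j (x *)

  Efficient : Fin m → Fin m → Carrier → Set
  Efficient i j x = Separates i j x × (∀ z → Separates i j z → ∣ x ∣ ≤ ∣ z ∣)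

  IsEfficient : Carrier → Set
  IsEfficient x = Σ (Fin m) λ i → Σ (Fin m) λ j → Efficient i j x

  Separates-* : ∀ {i j x} → Separates i j x → Separates j i (x *)
  Separates-* {i} (pix , pjx*) = pjx* , **⁺ (𝒫 i) pix

  Efficient-* : ∀ {i j x} → Efficient i j x → Efficient j i (x *)
  Efficient-* {x = x} (sep , minimal) = Separates-* sep , λ z sepz →
    subst₂ _≤_ (sym (∣∣-sym x)) (∣∣-sym z) (minimal (z *) (Separates-* sepz))

  IsEfficient-* : ∀ {x} → IsEfficient x → IsEfficient (x *)
  IsEfficient-* (i , j , eff) = j , i , Efficient-* eff

  Efficient-∣∣ : ∀ {i j x y} → Efficient i j x → Efficient i j y → ∣ x ∣ ≡ ∣ y ∣
  Efficient-∣∣ (sepx , minx) (sepy , miny) = ≤-antisym (minx _ sepy) (miny _ sepx)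

  Separates? : ∀ i j → Decidable (Separates i j)
  Separates? i j z = 𝒫.P? i z ×-dec 𝒫.P? j (z *)

  efficient-exists : ∀ {i j x} → Separates i j x → Σ Carrier (Efficient i j)
  efficient-exists {i} {j} = ∃-minimal ∣_∣ elements complete (Separates? i j)

  efficient? : ∀ i j → Dec (Σ Carrier (Efficient i j))
  efficient? i j with any? (Separates? i j) elements
  ... | yes some = yes (efficient-exists (proj₂ (satisfied some)))
  ... | no none = no λ (x , sep , _) → none (lose (complete x) sep)

  *∈-above-shorter : ∀ {a b s s′} → Efficient a b s → s ≤ˢ s′ → ∣ s′ ∣ < ∣ s ∣ →
                     𝒫 a (s′ *) × 𝒫 b (s′ *)
  *∈-above-shorter {a} {b} {s} {s′} ((pas , pbs*) , minimal) s≤s′ ∣s′∣<∣s∣ = pas′* , pbs′*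
    where
      pbs′* : 𝒫 b (s′ *)
      pbs′* = 𝒫.↓-closed-< b pbs* (*-antitone s≤s′)
                (subst₂ _<_ (sym (∣∣-sym s′)) (sym (∣∣-sym s)) ∣s′∣<∣s∣)
      pas′* : 𝒫 a (s′ *)
      pas′* with orient a (<-trans ∣s′∣<∣s∣ (∣∣<k a pas))
      ... | inj₁ pas′ = ⊥-elim (<⇒≱ ∣s′∣<∣s∣ (minimal s′ (pas′ , pbs′*)))
      ... | inj₂ pas′* = pas′*

  ¬Nested-below-maximal : ∀ {T i a b s y} → MaximalIn U (𝒫 i) T s → Efficient a b s →
                          T y → Separates i a y → ∣ y ∣ < ∣ s ∣ → ¬ Nested U y s
  ¬Nested-below-maximal {i = i} {a} {b} {s} {y} (pis , _ , maximal) ((pas , pbs*) , minimal)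
                        Ty (piy , pay*) ∣y∣<∣s∣ = λ where
    (⟨≤⟩ y≤s) → 𝒫.¬both a (𝒫.↓-closed-< a pas y≤s ∣y∣<∣s∣) pay*
    (⟨≤*⟩ y≤s*) → <⇒≱ ∣y∣<∣s∣
      (subst (∣ s ∣ ≤_) (∣∣-sym y) (minimal (y *) (pay* , **⁺ (𝒫 b) (𝒫.↓-closed-< b pbs* y≤s*
        (subst (∣ y ∣ <_) (sym (∣∣-sym s)) ∣y∣<∣s∣)))))
    (⟨*≤⟩ y*≤s) → IsKProfile.consistent (proj₂ (isProfile i)) y s piy pis
      (λ same → <-irrefl (SameSep-∣∣ same) ∣y∣<∣s∣) y*≤s
    (⟨*≤*⟩ y*≤s*) → <-irrefl (cong ∣_∣ (maximal y piy Ty (a*≤b*⇒b≤a y*≤s*))) ∣y∣<∣s∣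

  maximal-∣∣-minimal : (T : OSet U) → NestedSet U T → (∀ s → T s → IsEfficient s) →
                       (∀ i j → i ≢ j → Σ Carrier λ y → T y × Efficient i j y) →
                       ∀ i s s′ → MaximalIn U (𝒫 i) T s → 𝒫 i s′ → s ≤ˢ s′ → ∣ s ∣ ≤ ∣ s′ ∣
  maximal-∣∣-minimal T nested efficient covers i s s′ max@(_ , Ts , _) pis′ s≤s′
    with ∣ s ∣ ≤? ∣ s′ ∣ | efficient s Ts
  ... | yes ∣s∣≤∣s′∣ | _ = ∣s∣≤∣s′∣
  ... | no ∣s∣≰∣s′∣ | a , b , eff = ⊥-elim (impossible (covers i a i≢a))
    where
      ∣s′∣<∣s∣ : ∣ s′ ∣ < ∣ s ∣
      ∣s′∣<∣s∣ = ≰⇒> ∣s∣≰∣s′∣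
      pas′* : 𝒫 a (s′ *)
      pas′* = proj₁ (*∈-above-shorter eff s≤s′ ∣s′∣<∣s∣)
      i≢a : i ≢ a
      i≢a refl = 𝒫.¬both i pis′ pas′*
      impossible : Σ Carrier (λ y → T y × Efficient i a y) → ⊥
      impossible (y , Ty , sepy , miny) = ¬Nested-below-maximal max eff Ty sepy
        (≤-<-trans (miny s′ (pis′ , pas′*)) ∣s′∣<∣s∣) (nested y s Ty Ts)

module Uncrossing (U : Universe) {m : ℕ} (𝒫 : Fin m → OSet U)
                  (isProfile : ∀ i → IsProfile U (𝒫 i)) (robust : ∀ i → StronglyRobust U (𝒫 i)) where
  open Separations U
  open Efficiency U 𝒫 isProfile

  Replacement : Fin m → Fin m → Carrier → Carrier → Set
  Replacement i j r s =
    Σ Carrier λ c → Efficient i j c × Nested U r c × (∀ t → Nested U t r → Nested U t s → Nested U t c)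

  Replacement-* : ∀ {i j w s} → Replacement i j (w *) s → Replacement i j w s
  Replacement-* (c , eff , w*∥c , inherit) = c , eff , Nested-*ˡ⁻ w*∥c , λ t t∥w t∥s → inherit t (Nested-*ʳ t∥w) t∥s

  module _ {i j : Fin m} {w s : Carrier} (w⋈s : Crossing w s) where
    ∨-replacement : Efficient i j s → 𝒫 i w → ∣ w ∨ s ∣ ≤ ∣ s ∣ → Replacement i j w s
    ∨-replacement ((pis , pjs*) , minimal) piw ∣w∨s∣≤∣s∣ =
      w ∨ s ,
      ((𝒫.∨-closed i piw pis (≤-<-trans ∣w∨s∣≤∣s∣ (∣∣<k i pis)) ,
        𝒫.↓-closed j pjs* (*-antitone (y≤x∨y w s))
          (subst (_< k j) (sym (∣∣-sym (w ∨ s))) (≤-<-trans ∣w∨s∣≤∣s∣ (∣*∣<k j pjs*)))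
          (Crossing⇒s*≢[w∨s]** w⋈s)) ,
       λ z sepz → ≤-trans ∣w∨s∣≤∣s∣ (minimal z sepz)) ,
      ⟨≤⟩ (x≤x∨y w s) , λ t → Nested-∨ w⋈s

    ∧-replacement : Efficient i j s → 𝒫 j (w *) → ∣ w ∧ s ∣ ≤ ∣ s ∣ → Replacement i j w s
    ∧-replacement ((pis , pjs*) , minimal) pjw* ∣w∧s∣≤∣s∣ =
      w ∧ s ,
      ((𝒫.↓-closed i pis (x∧y≤y w s) (≤-<-trans ∣w∧s∣≤∣s∣ (∣∣<k i pis)) (Crossing⇒s≢[w∧s]* w⋈s) ,
        subst (𝒫 j) (sym (*-∧ w s)) (𝒫.∨-closed j pjw* pjs*
          (subst (_< k j) (sym (∣*∨*∣ w s)) (≤-<-trans ∣w∧s∣≤∣s∣ (∣*∣<k j pjs*))))) ,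
       λ z sepz → ≤-trans ∣w∧s∣≤∣s∣ (minimal z sepz)) ,
      Nested-sym (⟨≤⟩ (x∧y≤x w s)) , λ t → Nested-∧ w⋈s

    separating-replacement : Efficient i j s → Separates i j w → ∣ w ∣ ≤ ∣ s ∣ → Replacement i j w s
    separating-replacement effs (piw , pjw*) ∣w∣≤∣s∣ with ∣ w ∨ s ∣ ≤? ∣ s ∣
    ... | yes ∣w∨s∣≤∣s∣ = ∨-replacement effs piw ∣w∨s∣≤∣s∣
    ... | no ∣w∨s∣≰∣s∣ = ∧-replacement effs pjw* (<⇒≤ (<-≤-trans (∣∧∣<∣∣-if-∣∣<∣∨∣ (≰⇒> ∣w∨s∣≰∣s∣)) ∣w∣≤∣s∣))

  ¬∈-shorter-join : ∀ {a b v} → Efficient a b v → ∀ t → ∣ v ∨ t ∣ < ∣ v ∣ → ¬ 𝒫 a (v ∨ t)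
  ¬∈-shorter-join {b = b} {v} ((_ , pbv*) , minimal) t ∣v∨t∣<∣v∣ pa =
    <⇒≱ ∣v∨t∣<∣v∣ (minimal (v ∨ t) (pa , 𝒫.↓-closed-< b pbv* (*-antitone (x≤x∨y v t))
      (subst₂ _<_ (sym (∣∣-sym (v ∨ t))) (sym (∣∣-sym v)) ∣v∨t∣<∣v∣)))

  -- If neither w * ∧ s nor w ∨ s has order at most |s|, submodularity makes both joins at w *
  -- shorter than w, and strong robustness of 𝒫 a puts one of them into 𝒫 a.
  co-oriented-replacement : ∀ {a b i j w s} → Crossing w s → Efficient a b (w *) →
                            Efficient i j s → 𝒫 i w → 𝒫 j w → Replacement i j w s
  co-oriented-replacement {a = a} {j = j} {w = w} {s = s} w⋈s effw* effs piw pjw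
    with ∣ (w *) ∧ s ∣ ≤? ∣ s ∣ | ∣ w ∨ s ∣ ≤? ∣ s ∣
  ... | yes ∣w*∧s∣≤∣s∣ | _ = Replacement-* (∧-replacement (Crossing-*ˡ w⋈s) effs (**⁺ (𝒫 j) pjw) ∣w*∧s∣≤∣s∣)
  ... | no _ | yes ∣w∨s∣≤∣s∣ = ∨-replacement w⋈s effs piw ∣w∨s∣≤∣s∣
  ... | no ∣w*∧s∣≰∣s∣ | no ∣w∨s∣≰∣s∣ = ⊥-elim ([ ¬∈-shorter-join effw* s ∣w*∨s∣<∣w*∣
                                                , ¬∈-shorter-join effw* (s *) ∣w*∨s*∣<∣w*∣ ]′
    (robust a (w *) s (proj₁ (proj₁ effw*)) (<⇒≤ ∣w*∨s∣<∣w*∣) (<⇒≤ ∣w*∨s*∣<∣w*∣)))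
    where
      ∣w*∨s∣<∣w*∣ : ∣ (w *) ∨ s ∣ < ∣ w * ∣
      ∣w*∨s∣<∣w*∣ = ∣∨∣<∣∣-if-∣∣<∣∧∣ (≰⇒> ∣w*∧s∣≰∣s∣)
      ∣w*∨s*∣<∣w*∣ : ∣ (w *) ∨ (s *) ∣ < ∣ w * ∣
      ∣w*∨s*∣<∣w*∣ = subst₂ _<_ (sym (∣*∨*∣ w s)) (sym (∣∣-sym w)) (∣∧∣<∣∣-if-∣∣<∣∨∣ (≰⇒> ∣w∨s∣≰∣s∣))

  uncross : ∀ {a b i j r s} → Efficient a b r → Efficient i j s → ∣ r ∣ ≤ ∣ s ∣ →
            Crossing r s → Replacement i j r s
  uncross {a} {b} {i} {j} {r} {s} effr effs@((pis , pjs*) , _) ∣r∣≤∣s∣ r⋈s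
    with orient i (≤-<-trans ∣r∣≤∣s∣ (∣∣<k i pis)) | orient j (≤-<-trans ∣r∣≤∣s∣ (∣*∣<k j pjs*))
  ... | inj₁ pir | inj₂ pjr* = separating-replacement r⋈s effs (pir , pjr*) ∣r∣≤∣s∣
  ... | inj₂ pir* | inj₁ pjr = Replacement-* (separating-replacement (Crossing-*ˡ r⋈s) effs
                                 (pir* , **⁺ (𝒫 j) pjr) (subst (_≤ ∣ s ∣) (sym (∣∣-sym r)) ∣r∣≤∣s∣))
  ... | inj₁ pir | inj₁ pjr = co-oriented-replacement r⋈s (Efficient-* effr) effs pir pjr
  ... | inj₂ pir* | inj₂ pjr* = Replacement-* (co-oriented-replacement (Crossing-*ˡ r⋈s)
                                  (subst (Efficient a b) (sym (*-invol r)) effr) effs pir* pjr*)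

module TreeSets (U : Universe) {m : ℕ} (𝒫 : Fin m → OSet U)
                (isProfile : ∀ i → IsProfile U (𝒫 i)) (robust : ∀ i → StronglyRobust U (𝒫 i)) where
  open Separations U
  open Efficiency U 𝒫 isProfile
  open Uncrossing U 𝒫 isProfile robust

  NestedList-∷ : ∀ {s L} → NestedList L → (∀ {t} → t ∈ L → Nested U t s) → NestedList (s ∷ L)
  NestedList-∷ nestedL L∥s (here refl) (here refl) = Nested-refl
  NestedList-∷ nestedL L∥s (here refl) (there y∈L) = Nested-sym (L∥s y∈L)
  NestedList-∷ nestedL L∥s (there x∈L) (here refl) = L∥s x∈L
  NestedList-∷ nestedL L∥s (there x∈L) (there y∈L) = nestedL x∈L y∈L

  EfficientUpTo : ℕ → List Carrier → Set
  EfficientUpTo n L = ∀ {t} → t ∈ L → IsEfficient t × ∣ t ∣ ≤ n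

  nested-efficient : ∀ {i j e} L → Efficient i j e → NestedList L → EfficientUpTo ∣ e ∣ L →
                     Σ Carrier λ s → Efficient i j s × (∀ {t} → t ∈ L → Nested U t s)
  nested-efficient {e = e} [] effe _ _ = e , effe , λ ()
  nested-efficient (r ∷ L) effe nestedL bounded
    with nested-efficient L effe (λ x∈L y∈L → nestedL (there x∈L) (there y∈L)) (bounded ∘ there)
  ... | s , effs , L∥s with Nested? r s
  ...   | yes r∥s = s , effs , λ { (here refl) → r∥s ; (there t∈L) → L∥s t∈L }
  ...   | no r⋈s with bounded (here refl)
  ...     | (_ , _ , effr) , ∣r∣≤∣e∣ with uncross effr effs (subst (∣ r ∣ ≤_) (Efficient-∣∣ effe effs) ∣r∣≤∣e∣) r⋈s
  ...       | c , effc , r∥c , inherit =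
    c , effc , λ { (here refl) → r∥c ; (there t∈L) → inherit _ (nestedL (there t∈L) (here refl)) (L∥s t∈L) }

  Stage : ℕ → List Carrier → Set
  Stage n L = NestedList L × EfficientUpTo n L

  Represented : Fin m → Fin m → List Carrier → Set
  Represented i j L = Σ Carrier λ y → y ∈ L × Efficient i j y

  Represented-⊆ : ∀ {i j L L′} → L ⊆ L′ → Represented i j L → Represented i j L′
  Represented-⊆ L⊆L′ (y , y∈L , effy) = y , L⊆L′ y∈L , effy

  RepresentedAt : ℕ → Fin m → Fin m → List Carrier → Set
  RepresentedAt n i j L = ∀ {x} → Efficient i j x → ∣ x ∣ ≡ n → Represented i j L

  Extension : ℕ → List Carrier → (List Carrier → Set) → Set
  Extension n L Goal = Σ (List Carrier) λ L′ → Stage n L′ × L ⊆ L′ × Goal L′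

  add-pair : ∀ {n L} → Stage n L → ∀ i j → Extension n L (RepresentedAt n i j)
  add-pair {n} {L} stage i j with efficient? i j
  ... | no none = L , stage , id , λ effx _ → ⊥-elim (none (_ , effx))
  ... | yes (e , effe) with ∣ e ∣ ≟ℕ n
  ...   | no ∣e∣≢n = L , stage , id , λ effx ∣x∣≡n → ⊥-elim (∣e∣≢n (trans (Efficient-∣∣ effe effx) ∣x∣≡n))
  ...   | yes refl with nested-efficient L effe (proj₁ stage) (proj₂ stage)
  ...     | s , effs , L∥s =
    s ∷ L , (NestedList-∷ (proj₁ stage) L∥s , bounded) , there , λ _ _ → s , here refl , effs
    where
      bounded : EfficientUpTo ∣ e ∣ (s ∷ L)
      bounded (here refl) = (i , j , effs) , subst (_≤ ∣ e ∣) (Efficient-∣∣ effe effs) ≤-refl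
      bounded (there t∈L) = proj₂ stage t∈L

  add-pairs : ∀ {n L} → Stage n L → ∀ ps →
              Extension n L (λ L′ → ∀ {i j} → (i , j) ∈ ps → RepresentedAt n i j L′)
  add-pairs {L = L} stage [] = L , stage , id , λ ()
  add-pairs stage ((i , j) ∷ ps) with add-pair stage i j
  ... | L₁ , stage₁ , L⊆L₁ , atL₁ with add-pairs stage₁ ps
  ...   | L′ , stage′ , L₁⊆L′ , atL′ = L′ , stage′ , L₁⊆L′ ∘ L⊆L₁ , λ where
    (here refl) effx ∣x∣≡n → Represented-⊆ L₁⊆L′ (atL₁ effx ∣x∣≡n)
    (there ij∈ps) → atL′ ij∈ps

  allPairs : List (Fin m × Fin m)
  allPairs = cartesianProduct (allFin m) (allFin m)

  Covered : (ℕ → Set) → List Carrier → Set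
  Covered Small L = ∀ {i j x} → Efficient i j x → Small ∣ x ∣ → Represented i j L

  complete-level : ∀ {n L} → Stage n L → Covered (_< n) L →
                   Σ (List Carrier) λ L′ → Stage n L′ × Covered (_≤ n) L′
  complete-level {n} stage coveredBelow with add-pairs stage allPairs
  ... | L′ , stage′ , L⊆L′ , atN = L′ , stage′ , covered
    where
      covered : Covered (_≤ n) L′
      covered {i} {j} effx ∣x∣≤n with m≤n⇒m<n∨m≡n ∣x∣≤n
      ... | inj₁ ∣x∣<n = Represented-⊆ L⊆L′ (coveredBelow effx ∣x∣<n)
      ... | inj₂ ∣x∣≡n = atN (∈-cartesianProduct⁺ (∈-allFin i) (∈-allFin j)) effx ∣x∣≡n

  build : ∀ n → Σ (List Carrier) λ L → Stage n L × Covered (_≤ n) L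
  build zero = complete-level {L = []} ((λ ()) , (λ ())) (λ _ ())
  build (suc n) with build n
  ... | L , (nestedL , bounded) , covered =
    complete-level (nestedL , λ t∈L → proj₁ (bounded t∈L) , m≤n⇒m≤1+n (proj₂ (bounded t∈L)))
                   (λ effx ∣x∣<1+n → covered effx (s≤s⁻¹ ∣x∣<1+n))

  tree : List Carrier
  tree = proj₁ (build maxOrder)

  tree-nested : NestedList tree
  tree-nested = proj₁ (proj₁ (proj₂ (build maxOrder)))

  tree-efficient : ∀ x → Orientations tree x → IsEfficient x
  tree-efficient x (t , t∈tree , inj₁ refl) = proj₁ (proj₂ (proj₁ (proj₂ (build maxOrder))) t∈tree)
  tree-efficient x (t , t∈tree , inj₂ refl) = IsEfficient-* (tree-efficient t (t , t∈tree , inj₁ refl))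

  tree-represents : ∀ {i j x} → Separates i j x → Σ Carrier λ y → Orientations tree y × Efficient i j y
  tree-represents sep with efficient-exists sep
  ... | e , effe with proj₂ (proj₂ (build maxOrder)) effe (∣∣≤maxOrder e)
  ...   | y , y∈tree , effy = y , (y , y∈tree , inj₁ refl) , effy

mainTheorem17 : (U : Universe) → let open Universe U in
    (m : ℕ) (𝒫 : Fin m → OSet U) →
    (∀ i → IsProfile U (𝒫 i)) → (∀ i → StronglyRobust U (𝒫 i)) →
    Distinguishable U m 𝒫 →
    Σ (OSet U) λ T → ClosedUnder* U T × NestedSet U T
      × (∀ i j → i ≢ j → Σ Carrier λ s → T s × Distinguishes U s (𝒫 i) (𝒫 j))
      × (∀ i s s′ → MaximalIn U (𝒫 i) T s → 𝒫 i s′ → s ≤ˢ s′ → ∣ s ∣ ≤ ∣ s′ ∣)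
mainTheorem17 U m 𝒫 isProfile robust distinguishable =
  Orientations tree , Orientations-closed tree , Orientations-nested tree-nested ,
  (λ i j i≢j → let y , Ty , sepy , _ = represents i j i≢j in y , Ty , y , inj₁ refl , sepy) ,
  maximal-∣∣-minimal (Orientations tree) (Orientations-nested tree-nested) tree-efficient represents
  where
    open Separations U
    open Efficiency U 𝒫 isProfile
    open TreeSets U 𝒫 isProfile robust

    represents : ∀ i j → i ≢ j → Σ Carrier λ y → Orientations tree y × Efficient i j y
    represents i j i≢j = tree-represents (proj₂ (proj₂ (proj₂ (distinguishable i j i≢j))))
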